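{- For each $k\ge1$ let $h^{L(k)}$ and $h^{R(k)}$ be left and right half-edge vectors of the same length $N(k)$, where $L(k)$ and $R(k)$ are the sets of distinct labels occurring in the respective vectors, and let $B_\pi(k)$ be the bipartite (multi)graph on $L(k)\cup R(k)$ induced by a uniformly random permutation $\pi_k\in\mathfrak S_{N(k)}$. If $|L(k)|\to\infty$, $|R(k)|\to\infty$ and $N(k)\to\infty$, then the sequence $(B_\pi(k))_k$ is asymptotically block-free, i.e. asymptotically block-free of order $s$ for every $s\ge2$.
   Context: Half-edge vectors: given a totally ordered left vertex set $L=\{u_1,\dots,u_n\}$ with degrees $w_i\ge1$ and a totally ordered right vertex set $R=\{v_1,\dots,v_m\}$ with degrees $d_j\ge1$, where $\sum_i w_i=N=\sum_j d_j$, the left half-edge vector is the length-$N$ sequence $h^L=(u_1,\dots,u_1,u_2,\dots,u_2,\dots,u_n,\dots,u_n)$ containing $w_1$ copies of $u_1$, then $w_2$ copies of $u_2$, etc.; the right half-edge vector $h^R$ is defined analogously with $d_j$ copies of $v_j$ in order. Given $\pi\in\mathfrak S_N$, the bipartite multigraph $B_\pi=(L\cup R,E)$ induced by $\pi$ has edge multiset $E=\{(h^L_p,h^R_{\pi(p)}):1\le p\le N\}$. Induced permutation: for a bipartite (multi)graph with ordered $L=\{u_1,\dots\}$ and $R=\{v_1,\dots\}$ and $s\ge2$, sample $s$ distinct edges $(u_{i(1)},v_{j(1)}),\dots,(u_{i(s)},v_{j(s)})$ listed with $i(1)\le\cdots\le i(s)$; the induced permutation $\sigma\in\mathfrak S_s$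 is chosen uniformly at random among those with $j(\sigma(1))\le\cdots\le j(\sigma(s))$. A sequence of random bipartite (multi)graphs whose numbers of left vertices, right vertices and edges tend to infinity is asymptotically block-free of order $s$ if the distribution of the permutation induced by a uniformly random sample of $s$ distinct edges converges to the uniform distribution on $\mathfrak S_s$. -}

module Defs where

open import Data.Bool using (Bool; true; false; if_then_else_)
open import Data.Nat as ℕ using (ℕ; zero; suc; _≤ᵇ_; _≤_)
open import Data.Nat using (_!)
open import Data.List using (List; []; _∷_; _++_; map; concatMap; replicate; filterᵇ; length; upTo; foldr)
open import Data.List.Properties using (≡-dec)
open import Data.Product using (_×_; _,_; proj₁; proj₂; ∃)
open import Data.Integer using (+_)
open import Data.Rational using (ℚ; 0ℚ; 1ℚ; _+_; _*_; _-_; ∣_∣; _/_)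
import Data.Rational as Q
open import Data.Fin using (Fin; toℕ)
open import Data.Fin.Permutation using (Permutation′; _⟨$⟩ʳ_)
open import Data.List using (allFin)
open import Relation.Nullary using (does)

nth : {A : Set} → A → List A → ℕ → A
nth d []       _       = d
nth d (x ∷ xs) zero    = x
nth d (x ∷ xs) (suc i) = nth d xs i

-- half-edge vector from a degree list (w₁,…,wₙ): labels 0,…,n-1 (0-based),
-- label i repeated wᵢ times, in order
halfEdgesFrom : ℕ → List ℕ → List ℕ
halfEdgesFrom i []       = []
halfEdgesFrom i (w ∷ ws) = replicate w i ++ halfEdgesFrom (suc i) ws

halfEdges : List ℕ → List ℕ
halfEdges = halfEdgesFrom 0

-- all orderings of a list (as lists; n! of them, counted with position)
insertAll : {A : Set} → A → List A → List (List A)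
insertAll x []       = (x ∷ []) ∷ []
insertAll x (y ∷ ys) = (x ∷ y ∷ ys) ∷ map (y ∷_) (insertAll x ys)

perms : {A : Set} → List A → List (List A)
perms []       = [] ∷ []
perms (x ∷ xs) = concatMap (insertAll x) (perms xs)

-- all sub-lists of length s (choices of s distinct positions), C(n,s) of them
combinations : {A : Set} → ℕ → List A → List (List A)
combinations zero    xs       = [] ∷ []
combinations (suc s) []       = []
combinations (suc s) (x ∷ xs) = map (x ∷_) (combinations s xs) ++ combinations (suc s) xs

sortedᵇ : List ℕ → Bool
sortedᵇ []           = true
sortedᵇ (x ∷ [])     = true
sortedᵇ (x ∷ y ∷ xs) = if x ≤ᵇ y then sortedᵇ (y ∷ xs) else false

-- division of a rational by a natural (0 if the natural is 0; never used then)
_/ℕ_ : ℚ → ℕ → ℚ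
q /ℕ zero  = 0ℚ
q /ℕ suc d = q * ((+ 1) / suc d)

-- expectation under the uniform distribution on a finite list of outcomes
avg : {A : Set} → List A → (A → ℚ) → ℚ
avg xs f = foldr _+_ 0ℚ (map f xs) /ℕ length xs

Edge : Set
Edge = ℕ × ℕ

-- edge list of B_π: edge p is (hᴸ_p , hᴿ_{π(p)}), π given by its table
edgesOf : List ℕ → List ℕ → List ℕ → List Edge
edgesOf hL hR π = map (λ p → nth 0 hL p , nth 0 hR (nth 0 π p)) (upTo (length hL))

-- listings of a sampled edge set with left labels weakly increasing
-- (ties among equal left labels broken uniformly at random)
listings : List Edge → List (List Edge)
listings S = filterᵇ (λ ℓ → sortedᵇ (map proj₁ ℓ)) (perms S)

-- permutations σ of {0,…,s-1} (as tables) with j(σ(1)) ≤ … ≤ j(σ(s))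
compatible : ℕ → List Edge → List (List ℕ)
compatible s ℓ = filterᵇ (λ σ → sortedᵇ (map (λ t → proj₂ (nth (0 , 0) ℓ t)) σ)) (perms (upTo s))

indicator : List ℕ → List ℕ → ℚ
indicator σ τ = if does (≡-dec ℕ._≟_ σ τ) then 1ℚ else 0ℚ

table : (s : ℕ) → Permutation′ s → List ℕ
table s σ = map (λ t → toℕ (σ ⟨$⟩ʳ t)) (allFin s)

-- Probability that the permutation induced by a uniformly random sample of s
-- distinct edges of B_π, π uniform in 𝔖_N, equals σ₀.
-- Degrees w (left) and d (right); N = length of hᴸ.
inducedProb : (w d : List ℕ) (s : ℕ) → List ℕ → ℚ
inducedProb w d s σ₀ =
  let hL = halfEdges w ; hR = halfEdges d in
  avg (perms (upTo (length hL))) λ π →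
  avg (combinations s (edgesOf hL hR π)) λ S →
  avg (listings S) λ ℓ →
  avg (compatible s ℓ) λ σ → indicator σ σ₀

sumℕ : List ℕ → ℕ
sumℕ = foldr ℕ._+_ 0

TendsToInfinity : (ℕ → ℕ) → Set
TendsToInfinity f = ∀ B → ∃ λ K → ∀ k → K ≤ k → B ≤ f k

BlockFreeOfOrder : (w d : ℕ → List ℕ) → ℕ → Set
BlockFreeOfOrder w d s =
  (σ₀ : Permutation′ s) → (ε : ℚ) → 0ℚ Q.< ε →
  ∃ λ K → ∀ k → K ≤ k →
    ∣ inducedProb (w k) (d k) s (table s σ₀) - (1ℚ /ℕ (s !)) ∣ Q.≤ ε

module Submission where

-- The permutation induced by a random sample of s edges of B_π is in fact
-- EXACTLY uniform on 𝔖ₛ as soon as there are N ≥ s edges, for all degree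
-- sequences; block-freeness of every order then follows since N → ∞.
-- Permutations of {0,…,n-1} are handled as tables (lists of images) and 𝔖ₙ
-- is the list of all of them.  For a sample at half-edge positions P, the
-- left-sorted listings are P ⊙ α for α ∈ leftSortings P, and the compatible σ
-- equals τ₀ with probability weight (π ⊙ P ⊙ α ⊙ τ₀), where weight v is the
-- indicator that v is right-sorted divided by the number of orderings sorting v.
-- Two symmetries conclude: (i) ∑_{π ∈ 𝔖_N} weight (π ⊙ Q) is the same for every
-- rearrangement Q of P (right translation in 𝔖_N), and (ii) the weights of the
-- s! reorderings of any v add up to 1 (left translation in 𝔖ₛ); so each total
-- is N!/s! and the probability is 1/s!.

open import Defs
open import Data.Bool using (Bool; true; false; if_then_else_; T)
open import Data.Empty using (⊥; ⊥-elim)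
open import Data.Fin using (Fin; toℕ)
import Data.Fin.Properties as Fin
open import Data.Fin.Permutation using (Permutation′; _⟨$⟩ʳ_; _⟨$⟩ˡ_; inverseˡ)
open import Data.Integer as ℤ using (ℤ)
open import Data.Integer.Tactic.RingSolver using (solve-∀)
open import Data.List using (List; []; _∷_; _++_; map; foldr; length; concatMap; filter; filterᵇ; replicate; upTo; applyUpTo; allFin; take)
import Data.List.Properties as List
open import Data.List.Membership.Propositional using (_∈_; find)
open import Data.List.Membership.Propositional.Properties using (∈-map⁺; ∈-map⁻; ∈-++⁺ˡ; ∈-++⁺ʳ; ∈-++⁻; ∈-∃++; ∈-upTo⁺; ∈-upTo⁻; ∈-filter⁺; ∈-filter⁻; ∈-length; ∈-concatMap⁺; ∈-concatMap⁻)
open import Data.List.Relation.Unary.Any as Any using (Any; here; there)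
open import Data.List.Relation.Unary.All as All using (All; []; _∷_)
import Data.List.Relation.Unary.All.Properties as AllP
open import Data.List.Relation.Unary.AllPairs using ([]; _∷_)
open import Data.List.Relation.Unary.Unique.Propositional using (Unique)
import Data.List.Relation.Unary.Unique.Propositional.Properties as Unique
open import Data.List.Relation.Binary.Subset.Propositional using (_⊆_)
open import Data.List.Relation.Binary.Permutation.Propositional using (_↭_; refl; prep; swap; trans; ↭-sym; ↭⇒↭ₛ)
open import Data.List.Relation.Binary.Permutation.Propositional.Properties using (All-resp-↭; ∈-resp-↭; shift; ↭-length; ↭-empty-inv; drop-mid; filter-↭; ++⁺ʳ)
import Data.List.Relation.Binary.Permutation.Propositional.Properties as Perm
import Data.List.Relation.Binary.Permutation.Setoid.Properties as PermSetoid
open import Data.Nat as ℕ using (ℕ; zero; suc; _≤_; _<_; z≤n; s≤s; _!; _≤ᵇ_)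
import Data.Nat.Properties as ℕ
open import Data.List.Membership.DecPropositional ℕ._≟_ using (_∈?_; _∉?_)
import Data.Nat.Coprimality as Coprime
open import Data.Product using (_×_; _,_; proj₁; proj₂; Σ-syntax)
open import Data.Rational using (ℚ; 0ℚ; 1ℚ; _+_; _*_; _-_; _/_; ∣_∣; mkℚ; toℚᵘ; 1/_)
import Data.Rational as ℚ
open import Data.Rational.Properties using (+-identityˡ; +-identityʳ; +-assoc; +-comm; *-identityˡ; *-identityʳ; *-assoc; *-comm; *-zeroˡ; *-zeroʳ; *-distribʳ-+; *-inverseʳ; +-inverseʳ; <⇒≤; ↥p/↧p≡p; toℚᵘ-injective; toℚᵘ-homo-+; toℚᵘ-cong; toℚᵘ-fromℚᵘ; +-0-isCommutativeMonoid)
import Data.Rational.Unnormalised as ℚᵘ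
import Data.Rational.Unnormalised.Properties as ℚᵘ
open import Data.Sum using (inj₁; inj₂)
open import Function using (_∘_; id)
open import Relation.Nullary using (¬?; Dec; yes; no)
open import Relation.Nullary.Decidable using (T?; decidable-stable)
open import Relation.Binary.Definitions using (DecidableEquality)
open import Relation.Binary.PropositionalEquality as ≡ using (_≡_; _≢_; cong; cong₂; subst)

fromℕ : ℕ → ℚ
fromℕ zero    = 0ℚ
fromℕ (suc n) = 1ℚ + fromℕ n

-- fromℕ agrees with the normalised fraction n/1; checked in ℚᵘ, where + is
-- computed without normalisation and 1/1 + n/1 = (1+n)/1 is cross-multiplication.
fromℕ≡n/1 : ∀ n → fromℕ n ≡ (ℤ.+ n) / 1
fromℕ≡n/1 zero    = ≡.refl
fromℕ≡n/1 (suc n) = toℚᵘ-injective (begin-equality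
  toℚᵘ (1ℚ + fromℕ n)                          ≃⟨ toℚᵘ-homo-+ 1ℚ (fromℕ n) ⟩
  toℚᵘ 1ℚ ℚᵘ.+ toℚᵘ (fromℕ n)                 ≃⟨ ℚᵘ.+-congʳ (toℚᵘ 1ℚ) (toℚᵘ-cong (fromℕ≡n/1 n)) ⟩
  toℚᵘ 1ℚ ℚᵘ.+ toℚᵘ ((ℤ.+ n) / 1)             ≃⟨ ℚᵘ.+-congʳ (toℚᵘ 1ℚ) (toℚᵘ-fromℚᵘ (ℚᵘ.mkℚᵘ (ℤ.+ n) 0)) ⟩
  ℚᵘ.mkℚᵘ (ℤ.+ 1) 0 ℚᵘ.+ ℚᵘ.mkℚᵘ (ℤ.+ n) 0    ≃⟨ ℚᵘ.*≡* (one-plus-n (ℤ.+ n)) ⟩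
  ℚᵘ.mkℚᵘ (ℤ.+ suc n) 0                        ≃⟨ ℚᵘ.≃-sym (toℚᵘ-fromℚᵘ (ℚᵘ.mkℚᵘ (ℤ.+ suc n) 0)) ⟩
  toℚᵘ ((ℤ.+ suc n) / 1)                       ∎)
  where
  open ℚᵘ.≤-Reasoning
  one-plus-n : ∀ (m : ℤ) → ((ℤ.+ 1) ℤ.* (ℤ.+ 1) ℤ.+ m ℤ.* (ℤ.+ 1)) ℤ.* (ℤ.+ 1)
                              ≡ ((ℤ.+ 1) ℤ.+ m) ℤ.* ((ℤ.+ 1) ℤ.* (ℤ.+ 1))
  one-plus-n = solve-∀

open ≡.≡-Reasoning

fromℕ-*-reciprocal : ∀ d → fromℕ (suc d) * ((ℤ.+ 1) / suc d) ≡ 1ℚ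
fromℕ-*-reciprocal d = begin
  fromℕ (suc d) * ((ℤ.+ 1) / suc d) ≡⟨ cong₂ _*_ (≡.trans (fromℕ≡n/1 (suc d)) (↥p/↧p≡p q)) (↥p/↧p≡p (1/ q)) ⟩
  q * 1/ q                          ≡⟨ *-inverseʳ q ⟩
  1ℚ                                ∎
  where
  q : ℚ
  q = mkℚ (ℤ.+ suc d) 0 (Coprime.sym (Coprime.1-coprimeTo (suc d)))

/ℕ-unique : ∀ m x y → 1 ≤ m → fromℕ m * y ≡ x → x /ℕ m ≡ y
/ℕ-unique (suc d) x y _ my≡x = begin
  x * r                  ≡⟨ cong (_* r) (≡.sym my≡x) ⟩
  (fromℕ (suc d) * y) * r ≡⟨ *-assoc (fromℕ (suc d)) y r ⟩
  fromℕ (suc d) * (y * r) ≡⟨ cong (fromℕ (suc d) *_) (*-comm y r) ⟩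
  fromℕ (suc d) * (r * y) ≡⟨ ≡.sym (*-assoc (fromℕ (suc d)) r y) ⟩
  (fromℕ (suc d) * r) * y ≡⟨ cong (_* y) (fromℕ-*-reciprocal d) ⟩
  1ℚ * y                  ≡⟨ *-identityˡ y ⟩
  y                       ∎
  where
  r : ℚ
  r = (ℤ.+ 1) / suc d

*-1/ℕ : ∀ x m → x * (1ℚ /ℕ m) ≡ x /ℕ m
*-1/ℕ x zero    = *-zeroʳ x
*-1/ℕ x (suc m) = cong (x *_) (*-identityˡ _)

∑ : {A : Set} → List A → (A → ℚ) → ℚ
∑ xs f = foldr _+_ 0ℚ (map f xs)

∑-map : {A B : Set} (g : A → B) (xs : List A) (f : B → ℚ) → ∑ (map g xs) f ≡ ∑ xs (f ∘ g)
∑-map g []       f = ≡.refl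
∑-map g (x ∷ xs) f = cong (f (g x) +_) (∑-map g xs f)

∑-cong : {A : Set} (xs : List A) {f g : A → ℚ} → (∀ {x} → x ∈ xs → f x ≡ g x) → ∑ xs f ≡ ∑ xs g
∑-cong []       f≗g = ≡.refl
∑-cong (x ∷ xs) f≗g = cong₂ _+_ (f≗g (here ≡.refl)) (∑-cong xs (f≗g ∘ there))

∑-↭ : {A : Set} {xs ys : List A} (f : A → ℚ) → xs ↭ ys → ∑ xs f ≡ ∑ ys f
∑-↭ f xs↭ys = PermSetoid.foldr-commMonoid (≡.setoid ℚ) +-0-isCommutativeMonoid (↭⇒↭ₛ (Perm.map⁺ f xs↭ys))

∑-+ : {A : Set} (xs : List A) (f g : A → ℚ) → ∑ xs (λ x → f x + g x) ≡ ∑ xs f + ∑ xs g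
∑-+ []       f g = ≡.sym (+-identityˡ 0ℚ)
∑-+ (x ∷ xs) f g = begin
  (f x + g x) + ∑ xs (λ x → f x + g x) ≡⟨ cong ((f x + g x) +_) (∑-+ xs f g) ⟩
  (f x + g x) + (F + G)               ≡⟨ +-assoc (f x) (g x) (F + G) ⟩
  f x + (g x + (F + G))               ≡⟨ cong (f x +_) (≡.sym (+-assoc (g x) F G)) ⟩
  f x + ((g x + F) + G)               ≡⟨ cong (λ t → f x + (t + G)) (+-comm (g x) F) ⟩
  f x + ((F + g x) + G)               ≡⟨ cong (f x +_) (+-assoc F (g x) G) ⟩
  f x + (F + (g x + G))               ≡⟨ ≡.sym (+-assoc (f x) F (g x + G)) ⟩
  (f x + F) + (g x + G)               ∎
  where
  F = ∑ xs f
  G = ∑ xs g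

∑-zero : {A : Set} (xs : List A) → ∑ xs (λ _ → 0ℚ) ≡ 0ℚ
∑-zero []       = ≡.refl
∑-zero (x ∷ xs) = ≡.trans (+-identityˡ _) (∑-zero xs)

∑-*ʳ : {A : Set} (xs : List A) (c : ℚ) (f : A → ℚ) → ∑ xs (λ x → f x * c) ≡ ∑ xs f * c
∑-*ʳ []       c f = ≡.sym (*-zeroˡ c)
∑-*ʳ (x ∷ xs) c f = ≡.trans (cong (f x * c +_) (∑-*ʳ xs c f)) (≡.sym (*-distribʳ-+ c (f x) _))

∑-/ℕ : {A : Set} (xs : List A) (m : ℕ) (f : A → ℚ) → ∑ xs (λ x → f x /ℕ m) ≡ ∑ xs f /ℕ m
∑-/ℕ xs zero    f = ∑-zero xs
∑-/ℕ xs (suc m) f = ∑-*ʳ xs _ f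

∑-const : {A : Set} (xs : List A) (c : ℚ) → ∑ xs (λ _ → c) ≡ fromℕ (length xs) * c
∑-const []       c = ≡.sym (*-zeroˡ c)
∑-const (x ∷ xs) c = begin
  c + ∑ xs (λ _ → c)              ≡⟨ cong₂ _+_ (≡.sym (*-identityˡ c)) (∑-const xs c) ⟩
  1ℚ * c + fromℕ (length xs) * c  ≡⟨ ≡.sym (*-distribʳ-+ c 1ℚ (fromℕ (length xs))) ⟩
  (1ℚ + fromℕ (length xs)) * c    ∎

∑-swap : {A B : Set} (xs : List A) (ys : List B) (f : A → B → ℚ) →
         ∑ xs (λ x → ∑ ys (f x)) ≡ ∑ ys (λ y → ∑ xs (λ x → f x y))
∑-swap []       ys f = ≡.sym (∑-zero ys)
∑-swap (x ∷ xs) ys f = ≡.trans (cong (∑ ys (f x) +_) (∑-swap xs ys f))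
                               (≡.sym (∑-+ ys (f x) (λ y → ∑ xs (λ x′ → f x′ y))))

[_] : Bool → ℚ
[ true  ] = 1ℚ
[ false ] = 0ℚ

∑-filter : {A : Set} (p : A → Bool) (xs : List A) (f : A → ℚ) →
           ∑ (filterᵇ p xs) f ≡ ∑ xs (λ x → if p x then f x else 0ℚ)
∑-filter p []       f = ≡.refl
∑-filter p (x ∷ xs) f with p x
... | true  = cong (f x +_) (∑-filter p xs f)
... | false = ≡.trans (∑-filter p xs f) (≡.sym (+-identityˡ _))

count≡∑ : {A : Set} (p : A → Bool) (xs : List A) → fromℕ (length (filterᵇ p xs)) ≡ ∑ xs (λ x → [ p x ])
count≡∑ p []       = ≡.refl
count≡∑ p (x ∷ xs) with p x
... | true  = cong (1ℚ +_) (count≡∑ p xs)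
... | false = ≡.trans (count≡∑ p xs) (≡.sym (+-identityˡ _))

map-cong-∈ : {A B : Set} (xs : List A) {f g : A → B} → (∀ {x} → x ∈ xs → f x ≡ g x) → map f xs ≡ map g xs
map-cong-∈ xs f≗g = List.map-cong-local (All.tabulate f≗g)

map-≡⇒∈-≡ : {A B : Set} (xs : List A) {f g : A → B} → map f xs ≡ map g xs → ∀ {x} → x ∈ xs → f x ≡ g x
map-≡⇒∈-≡ (y ∷ xs) eq (here ≡.refl) = List.∷-injectiveˡ eq
map-≡⇒∈-≡ (y ∷ xs) eq (there x∈xs)  = map-≡⇒∈-≡ xs (List.∷-injectiveʳ eq) x∈xs

map-injective-on : {A B : Set} {f : A → B} (xs ys : List A) →
                   (∀ {x y} → x ∈ xs → y ∈ ys → f x ≡ f y → x ≡ y) → map f xs ≡ map f ys → xs ≡ ys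
map-injective-on []       []       inj eq = ≡.refl
map-injective-on (x ∷ xs) (y ∷ ys) inj eq =
  cong₂ _∷_ (inj (here ≡.refl) (here ≡.refl) (List.∷-injectiveˡ eq))
            (map-injective-on xs ys (λ x∈ y∈ → inj (there x∈) (there y∈)) (List.∷-injectiveʳ eq))

map-unique-on : {A B : Set} {f : A → B} {xs : List A} → Unique xs →
                (∀ {x y} → x ∈ xs → y ∈ xs → f x ≡ f y → x ≡ y) → Unique (map f xs)
map-unique-on {xs = []}     []           inj = []
map-unique-on {f = f} {xs = x ∷ xs} (x∉xs ∷ xs!) inj =
  AllP.map⁺ (All.tabulate fresh) ∷ map-unique-on xs! (λ x∈ y∈ → inj (there x∈) (there y∈))
  where
  fresh : ∀ {y} → y ∈ xs → f x ≢ f y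
  fresh y∈xs fx≡fy = All.lookup x∉xs y∈xs (inj (here ≡.refl) (there y∈xs) fx≡fy)

Unique-resp-↭ : {A : Set} {xs ys : List A} → xs ↭ ys → Unique xs → Unique ys
Unique-resp-↭ {A} xs↭ys = PermSetoid.Unique-resp-↭ (≡.setoid A) (↭⇒↭ₛ xs↭ys)

nth-map : {A B : Set} (f : A → B) (a : A) (b : B) (xs : List A) (i : ℕ) → i < length xs →
          nth b (map f xs) i ≡ f (nth a xs i)
nth-map f a b (x ∷ xs) zero    _         = ≡.refl
nth-map f a b (x ∷ xs) (suc i) (s≤s i<n) = nth-map f a b xs i i<n

nth-∈ : {A : Set} (a : A) (xs : List A) (i : ℕ) → i < length xs → nth a xs i ∈ xs
nth-∈ a (x ∷ xs) zero    _         = here ≡.refl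
nth-∈ a (x ∷ xs) (suc i) (s≤s i<n) = there (nth-∈ a xs i i<n)

nth-ext : {A : Set} (a : A) (xs ys : List A) → length xs ≡ length ys →
          (∀ i → i < length xs → nth a xs i ≡ nth a ys i) → xs ≡ ys
nth-ext a []       []       _   _  = ≡.refl
nth-ext a (x ∷ xs) (y ∷ ys) len eq =
  cong₂ _∷_ (eq 0 (s≤s z≤n)) (nth-ext a xs ys (ℕ.suc-injective len) (λ i i<n → eq (suc i) (s≤s i<n)))

nth-injective : {A : Set} (a : A) (xs : List A) → Unique xs → ∀ i j → i < length xs → j < length xs →
                nth a xs i ≡ nth a xs j → i ≡ j
nth-injective a (x ∷ xs) _            zero    zero    _         _         _ = ≡.refl
nth-injective a (x ∷ xs) (x∉xs ∷ _)   zero    (suc j) _         (s≤s j<n) e =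
  ⊥-elim (All.lookup x∉xs (nth-∈ a xs j j<n) e)
nth-injective a (x ∷ xs) (x∉xs ∷ _)   (suc i) zero    (s≤s i<n) _         e =
  ⊥-elim (All.lookup x∉xs (nth-∈ a xs i i<n) (≡.sym e))
nth-injective a (x ∷ xs) (_ ∷ xs!)    (suc i) (suc j) (s≤s i<n) (s≤s j<n) e =
  cong suc (nth-injective a xs xs! i j i<n j<n e)

upTo-suc : ∀ n → upTo (suc n) ≡ 0 ∷ map suc (upTo n)
upTo-suc n = cong (0 ∷_) (≡.sym (List.map-upTo suc n))

map-nth-upTo : {A : Set} (a : A) (xs : List A) → map (nth a xs) (upTo (length xs)) ≡ xs
map-nth-upTo a []       = ≡.refl
map-nth-upTo a (x ∷ xs) = cong (x ∷_) (begin
  map (nth a (x ∷ xs)) (applyUpTo suc (length xs)) ≡⟨ List.map-applyUpTo suc (nth a (x ∷ xs)) (length xs) ⟩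
  applyUpTo (nth a xs) (length xs)                 ≡⟨ ≡.sym (List.map-upTo (nth a xs) (length xs)) ⟩
  map (nth a xs) (upTo (length xs))                ≡⟨ map-nth-upTo a xs ⟩
  xs                                               ∎)

extract : {A : Set} {x : A} {ys : List A} → x ∈ ys → Σ[ ys′ ∈ List A ] (ys ↭ x ∷ ys′)
extract {x = x} x∈ys with as , bs , ≡.refl ← ∈-∃++ x∈ys = as ++ bs , shift x as bs

⊆-extract : {A : Set} {x : A} {xs ys ys′ : List A} → All (x ≢_) xs → x ∷ xs ⊆ ys →
            ys ↭ x ∷ ys′ → xs ⊆ ys′
⊆-extract x∉xs sub ys↭ z∈xs with ∈-resp-↭ ys↭ (sub (there z∈xs))
... | here ≡.refl = ⊥-elim (All.lookup x∉xs z∈xs ≡.refl)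
... | there z∈ys′ = z∈ys′

unique-length : {A : Set} {xs ys : List A} → Unique xs → xs ⊆ ys → length xs ≤ length ys
unique-length {xs = []}     _            _   = z≤n
unique-length {xs = x ∷ xs} (x∉xs ∷ xs!) sub with ys′ , ys↭ ← extract (sub (here ≡.refl)) =
  subst (suc (length xs) ≤_) (≡.sym (↭-length ys↭)) (s≤s (unique-length xs! (⊆-extract x∉xs sub ys↭)))

unique-↭ : {A : Set} {xs ys : List A} → Unique xs → Unique ys → xs ⊆ ys → length ys ≤ length xs → xs ↭ ys
unique-↭ {xs = []}     {[]}    _            _   _   _   = refl
unique-↭ {xs = []}     {_ ∷ _} _            _   _   ()
unique-↭ {xs = x ∷ xs}         (x∉xs ∷ xs!) ys! sub len
  with ys′ , ys↭ ← extract (sub (here ≡.refl))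
  with _ ∷ ys′! ← Unique-resp-↭ ys↭ ys! =
  trans (prep x (unique-↭ xs! ys′! (⊆-extract x∉xs sub ys↭) (ℕ.≤-pred (subst (_≤ suc (length xs)) (↭-length ys↭) len))))
        (↭-sym ys↭)

insertAll-∈⁺ : {A : Set} (x : A) (as bs : List A) → (as ++ x ∷ bs) ∈ insertAll x (as ++ bs)
insertAll-∈⁺ x []       []       = here ≡.refl
insertAll-∈⁺ x []       (b ∷ bs) = here ≡.refl
insertAll-∈⁺ x (a ∷ as) bs       = there (∈-map⁺ (a ∷_) (insertAll-∈⁺ x as bs))

insertAll-∈⁻ : {A : Set} (x : A) (zs : List A) {ys : List A} → ys ∈ insertAll x zs →
               Σ[ as ∈ List A ] Σ[ bs ∈ List A ] (zs ≡ as ++ bs × ys ≡ as ++ x ∷ bs)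
insertAll-∈⁻ x []       (here ≡.refl) = [] , [] , ≡.refl , ≡.refl
insertAll-∈⁻ x (z ∷ zs) (here ≡.refl) = [] , z ∷ zs , ≡.refl , ≡.refl
insertAll-∈⁻ x (z ∷ zs) (there y∈)
  with ys′ , ys′∈ , ≡.refl ← ∈-map⁻ (z ∷_) y∈
  with as , bs , ≡.refl , ≡.refl ← insertAll-∈⁻ x zs ys′∈ = z ∷ as , bs , ≡.refl , ≡.refl

∈perms⇒↭ : {A : Set} (xs : List A) {ys : List A} → ys ∈ perms xs → ys ↭ xs
∈perms⇒↭ []       (here ≡.refl) = refl
∈perms⇒↭ (x ∷ xs) y∈
  with zs , zs∈ , y∈′ ← find (∈-concatMap⁻ (insertAll x) {xs = perms xs} y∈)
  with as , bs , ≡.refl , ≡.refl ← insertAll-∈⁻ x zs y∈′ =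
  trans (shift x as bs) (prep x (∈perms⇒↭ xs zs∈))

↭⇒∈perms : {A : Set} (xs : List A) {ys : List A} → ys ↭ xs → ys ∈ perms xs
↭⇒∈perms []       ys↭[] with ≡.refl ← ↭-empty-inv ys↭[] = here ≡.refl
↭⇒∈perms (x ∷ xs) ys↭
  with as , bs , ≡.refl ← ∈-∃++ (∈-resp-↭ (↭-sym ys↭) (here ≡.refl)) =
  ∈-concatMap⁺ (insertAll x) (Any.map (λ { ≡.refl → insertAll-∈⁺ x as bs })
                                      (↭⇒∈perms xs (drop-mid as [] ys↭)))

unique-concatMap : {A B : Set} (g : A → List B) (xs : List A) → Unique xs → (∀ {x} → x ∈ xs → Unique (g x)) →
                   (∀ {x x′ y} → x ∈ xs → x′ ∈ xs → y ∈ g x → y ∈ g x′ → x ≡ x′) → Unique (concatMap g xs)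
unique-concatMap g []       _            _       _        = []
unique-concatMap g (x ∷ xs) (x∉xs ∷ xs!) blocks! disjoint =
  Unique.++⁺ (blocks! (here ≡.refl))
             (unique-concatMap g xs xs! (blocks! ∘ there) (λ x∈ x′∈ → disjoint (there x∈) (there x′∈)))
             (λ (y∈gx , y∈rest) → apart y∈gx y∈rest)
  where
  apart : ∀ {y} → y ∈ g x → y ∈ concatMap g xs → ⊥
  apart y∈gx y∈rest with x′ , x′∈ , y∈gx′ ← find (∈-concatMap⁻ g {xs = xs} y∈rest) =
    All.lookup x∉xs x′∈ (disjoint (here ≡.refl) (there x′∈) y∈gx y∈gx′)

module _ {A : Set} (_≟_ : DecidableEquality A) where

  private
    differs? : (x y : A) → Dec (x ≢ y)
    differs? x y = ¬? (x ≟ y)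

    delete : A → List A → List A
    delete x = filter (differs? x)

  delete-insertAll : (x : A) (zs : List A) {ys : List A} → ys ∈ insertAll x zs → All (x ≢_) zs → delete x ys ≡ zs
  delete-insertAll x zs y∈ x∉zs with as , bs , ≡.refl , ≡.refl ← insertAll-∈⁻ x zs y∈ = begin
    delete x (as ++ x ∷ bs)             ≡⟨ List.filter-++ (differs? x) as (x ∷ bs) ⟩
    delete x as ++ delete x (x ∷ bs)    ≡⟨ cong (delete x as ++_) (List.filter-reject (differs? x) (λ x≢x → x≢x ≡.refl)) ⟩
    delete x as ++ delete x bs          ≡⟨ cong₂ _++_ (List.filter-all (differs? x) (AllP.++⁻ˡ as x∉zs)) (List.filter-all (differs? x) (AllP.++⁻ʳ as x∉zs)) ⟩
    as ++ bs                            ∎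

  insertAll-unique : (x : A) (zs : List A) → All (x ≢_) zs → Unique (insertAll x zs)
  insertAll-unique x []       _              = [] ∷ []
  insertAll-unique x (z ∷ zs) (x≢z ∷ x∉zs) =
    AllP.map⁺ (All.tabulate (λ _ eq → x≢z (List.∷-injectiveˡ eq)))
    ∷ Unique.map⁺ List.∷-injectiveʳ (insertAll-unique x zs x∉zs)

  perms-unique : (xs : List A) → Unique xs → Unique (perms xs)
  perms-unique []       _            = [] ∷ []
  perms-unique (x ∷ xs) (x∉xs ∷ xs!) =
    unique-concatMap (insertAll x) (perms xs) (perms-unique xs xs!)
      (λ zs∈ → insertAll-unique x _ (x∉ zs∈))
      (λ zs∈ zs′∈ y∈ y∈′ → ≡.trans (≡.sym (delete-insertAll x _ y∈ (x∉ zs∈))) (delete-insertAll x _ y∈′ (x∉ zs′∈)))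
    where
    x∉ : ∀ {zs} → zs ∈ perms xs → All (x ≢_) zs
    x∉ zs∈ = All-resp-↭ (↭-sym (∈perms⇒↭ xs zs∈)) x∉xs

length-insertAll : {A : Set} (x : A) (zs : List A) → length (insertAll x zs) ≡ suc (length zs)
length-insertAll x []       = ≡.refl
length-insertAll x (z ∷ zs) = cong suc (≡.trans (List.length-map (z ∷_) (insertAll x zs)) (length-insertAll x zs))

length-concatMap : {A B : Set} (g : A → List B) (xs : List A) (k : ℕ) → (∀ {x} → x ∈ xs → length (g x) ≡ k) →
                   length (concatMap g xs) ≡ length xs ℕ.* k
length-concatMap g []       k _   = ≡.refl
length-concatMap g (x ∷ xs) k len = ≡.trans (List.length-++ (g x)) (cong₂ ℕ._+_ (len (here ≡.refl)) (length-concatMap g xs k (len ∘ there)))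

length-perms : {A : Set} (xs : List A) → length (perms xs) ≡ length xs !
length-perms []       = ≡.refl
length-perms (x ∷ xs) = begin
  length (concatMap (insertAll x) (perms xs)) ≡⟨ length-concatMap (insertAll x) (perms xs) (suc (length xs)) len ⟩
  length (perms xs) ℕ.* suc (length xs)       ≡⟨ cong (ℕ._* suc (length xs)) (length-perms xs) ⟩
  length xs ! ℕ.* suc (length xs)             ≡⟨ ℕ.*-comm (length xs !) _ ⟩
  suc (length xs) !                           ∎
  where
  len : ∀ {zs} → zs ∈ perms xs → length (insertAll x zs) ≡ suc (length xs)
  len {zs} zs∈ = ≡.trans (length-insertAll x zs) (cong suc (↭-length (∈perms⇒↭ xs zs∈)))

insertAll-map : {A B : Set} (f : A → B) (x : A) (ys : List A) → insertAll (f x) (map f ys) ≡ map (map f) (insertAll x ys)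
insertAll-map f x []       = ≡.refl
insertAll-map f x (y ∷ ys) = cong ((f x ∷ f y ∷ map f ys) ∷_) (begin
  map (f y ∷_) (insertAll (f x) (map f ys))   ≡⟨ cong (map (f y ∷_)) (insertAll-map f x ys) ⟩
  map (f y ∷_) (map (map f) (insertAll x ys)) ≡⟨ ≡.sym (List.map-∘ (insertAll x ys)) ⟩
  map (λ l → f y ∷ map f l) (insertAll x ys)  ≡⟨ List.map-∘ (insertAll x ys) ⟩
  map (map f) (map (y ∷_) (insertAll x ys))   ∎)

perms-map : {A B : Set} (f : A → B) (xs : List A) → perms (map f xs) ≡ map (map f) (perms xs)
perms-map f []       = ≡.refl
perms-map f (x ∷ xs) = begin
  concatMap (insertAll (f x)) (perms (map f xs))        ≡⟨ cong (concatMap (insertAll (f x))) (perms-map f xs) ⟩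
  concatMap (insertAll (f x)) (map (map f) (perms xs))  ≡⟨ List.concatMap-map (insertAll (f x)) (map f) (perms xs) ⟩
  concatMap (λ l → insertAll (f x) (map f l)) (perms xs) ≡⟨ List.concatMap-cong (insertAll-map f x) (perms xs) ⟩
  concatMap (map (map f) ∘ insertAll x) (perms xs)       ≡⟨ ≡.sym (List.map-concatMap (map f) (insertAll x) (perms xs)) ⟩
  map (map f) (concatMap (insertAll x) (perms xs))       ∎

-- Every rearrangement of xs is xs read off along a rearrangement of its
-- positions 0, …, n-1 (duplicates in xs included).
perms-positions : {A : Set} (a : A) (xs : List A) → perms xs ≡ map (map (nth a xs)) (perms (upTo (length xs)))
perms-positions a []       = ≡.refl
perms-positions a (x ∷ xs) = begin
  concatMap (insertAll x) (perms xs)                         ≡⟨ cong (concatMap (insertAll x)) (perms-positions a xs) ⟩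
  concatMap (insertAll x) (map (map (nth a xs)) positions)   ≡⟨ List.concatMap-map (insertAll x) (map (nth a xs)) positions ⟩
  concatMap (λ β → insertAll x (map (nth a xs) β)) positions ≡⟨ List.concatMap-cong shifted positions ⟩
  concatMap (map read ∘ insertAll 0 ∘ map suc) positions      ≡⟨ ≡.sym (List.concatMap-map (map read ∘ insertAll 0) (map suc) positions) ⟩
  concatMap (map read ∘ insertAll 0) (map (map suc) positions) ≡⟨ ≡.sym (List.map-concatMap read (insertAll 0) (map (map suc) positions)) ⟩
  map read (concatMap (insertAll 0) (map (map suc) positions)) ≡⟨ cong (map read ∘ concatMap (insertAll 0)) (≡.sym (perms-map suc (upTo (length xs)))) ⟩
  map read (perms (0 ∷ map suc (upTo (length xs))))           ≡⟨ cong (map read ∘ perms) (≡.sym (upTo-suc (length xs))) ⟩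
  map read (perms (upTo (suc (length xs))))                   ∎
  where
  positions = perms (upTo (length xs))
  read : List ℕ → List _
  read = map (nth a (x ∷ xs))
  shifted : ∀ β → insertAll x (map (nth a xs) β) ≡ map read (insertAll 0 (map suc β))
  shifted β = ≡.trans (cong (insertAll x) (List.map-∘ β)) (insertAll-map (nth a (x ∷ xs)) 0 (map suc β))

-- The symmetric group 𝔖ₙ: a permutation is represented by its table, the
-- list of the images of 0, …, n-1.
𝔖 : ℕ → List (List ℕ)
𝔖 n = perms (upTo n)

-- Composition of tables, (π ⊙ ρ)(t) = π(ρ(t)); ρ may also be any list of
-- positions of π.
_⊙_ : List ℕ → List ℕ → List ℕ
π ⊙ ρ = map (nth 0 π) ρ

𝔖-unique : ∀ n → Unique (𝔖 n)
𝔖-unique n = perms-unique ℕ._≟_ (upTo n) (Unique.upTo⁺ n)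

length-𝔖 : ∀ n → length (𝔖 n) ≡ n !
length-𝔖 n = ≡.trans (length-perms (upTo n)) (cong _! (List.length-upTo n))

module _ (n : ℕ) {π : List ℕ} (π∈𝔖 : π ∈ 𝔖 n) where

  𝔖-↭ : π ↭ upTo n
  𝔖-↭ = ∈perms⇒↭ (upTo n) π∈𝔖

  𝔖-length : length π ≡ n
  𝔖-length = ≡.trans (↭-length 𝔖-↭) (List.length-upTo n)

  𝔖-bounded : ∀ {x} → x ∈ π → x < n
  𝔖-bounded x∈π = ∈-upTo⁻ (∈-resp-↭ 𝔖-↭ x∈π)

  𝔖-position : ∀ (μ : List ℕ) → length μ ≡ n → ∀ {x} → x ∈ π → x < length μ
  𝔖-position _ len x∈π = subst (_ <_) (≡.sym len) (𝔖-bounded x∈π)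

  𝔖-entries-unique : Unique π
  𝔖-entries-unique = Unique-resp-↭ (↭-sym 𝔖-↭) (Unique.upTo⁺ n)

⊙-↭ : ∀ n (π ρ : List ℕ) → length π ≡ n → ρ ↭ upTo n → π ⊙ ρ ↭ π
⊙-↭ n π ρ len ρ↭ = subst (π ⊙ ρ ↭_) (≡.trans (cong (λ k → π ⊙ upTo k) (≡.sym len)) (map-nth-upTo 0 π))
                          (Perm.map⁺ (nth 0 π) ρ↭)

⊙-closed : ∀ n {π ρ} → π ∈ 𝔖 n → ρ ∈ 𝔖 n → π ⊙ ρ ∈ 𝔖 n
⊙-closed n π∈ ρ∈ = ↭⇒∈perms (upTo n) (trans (⊙-↭ n _ _ (𝔖-length n π∈) (𝔖-↭ n ρ∈)) (𝔖-↭ n π∈))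

⊙-assoc : (π μ ν : List ℕ) → (∀ {t} → t ∈ ν → t < length μ) → (π ⊙ μ) ⊙ ν ≡ π ⊙ (μ ⊙ ν)
⊙-assoc π μ ν ν<μ = ≡.trans (map-cong-∈ ν (λ {t} t∈ → nth-map (nth 0 π) 0 0 μ t (ν<μ t∈))) (List.map-∘ ν)

injective⇒↭ : ∀ n (g : List ℕ → List ℕ) → (∀ {π} → π ∈ 𝔖 n → g π ∈ 𝔖 n) →
              (∀ {π ρ} → π ∈ 𝔖 n → ρ ∈ 𝔖 n → g π ≡ g ρ → π ≡ ρ) → map g (𝔖 n) ↭ 𝔖 n
injective⇒↭ n g into inj =
  unique-↭ (map-unique-on (𝔖-unique n) inj) (𝔖-unique n) image⊆ (ℕ.≤-reflexive (≡.sym (List.length-map g (𝔖 n))))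
  where
  image⊆ : map g (𝔖 n) ⊆ 𝔖 n
  image⊆ y∈ with π , π∈ , ≡.refl ← ∈-map⁻ g y∈ = into π∈

left-translation : ∀ n {μ} → μ ∈ 𝔖 n → map (μ ⊙_) (𝔖 n) ↭ 𝔖 n
left-translation n {μ} μ∈ = injective⇒↭ n (μ ⊙_) (⊙-closed n μ∈)
  (λ {π} {π′} π∈ π′∈ eq → map-injective-on π π′
     (λ x∈ y∈ → nth-injective 0 μ (𝔖-entries-unique n μ∈) _ _
                  (𝔖-position n π∈ μ (𝔖-length n μ∈) x∈) (𝔖-position n π′∈ μ (𝔖-length n μ∈) y∈)) eq)

right-translation : ∀ n {ρ} → ρ ↭ upTo n → map (_⊙ ρ) (𝔖 n) ↭ 𝔖 n
right-translation n {ρ} ρ↭ = injective⇒↭ n (_⊙ ρ)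
  (λ {π} π∈ → ↭⇒∈perms (upTo n) (trans (⊙-↭ n π ρ (𝔖-length n π∈) ρ↭) (𝔖-↭ n π∈)))
  (λ {π} {π′} π∈ π′∈ eq → nth-ext 0 π π′ (≡.trans (𝔖-length n π∈) (≡.sym (𝔖-length n π′∈)))
     (λ i i<n → map-≡⇒∈-≡ ρ eq (∈-resp-↭ (↭-sym ρ↭) (∈-upTo⁺ (subst (i <_) (𝔖-length n π∈) i<n)))))

∑-reindex : {A : Set} {xs : List A} (g : A → A) → map g xs ↭ xs → (f : A → ℚ) → ∑ xs (f ∘ g) ≡ ∑ xs f
∑-reindex {xs = xs} g g↭ f = ≡.trans (≡.sym (∑-map g xs f)) (∑-↭ f g↭)

filterᵇ-map : {A B : Set} (p : B → Bool) (g : A → B) (xs : List A) → filterᵇ p (map g xs) ≡ map g (filterᵇ (p ∘ g) xs)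
filterᵇ-map p g []       = ≡.refl
filterᵇ-map p g (x ∷ xs) with p (g x)
... | true  = cong (g x ∷_) (filterᵇ-map p g xs)
... | false = filterᵇ-map p g xs

count-reindex : {A : Set} {xs : List A} (g : A → A) → map g xs ↭ xs → (p : A → Bool) →
                length (filterᵇ (p ∘ g) xs) ≡ length (filterᵇ p xs)
count-reindex {xs = xs} g g↭ p = begin
  length (filterᵇ (p ∘ g) xs)        ≡⟨ ≡.sym (List.length-map g (filterᵇ (p ∘ g) xs)) ⟩
  length (map g (filterᵇ (p ∘ g) xs)) ≡⟨ cong length (≡.sym (filterᵇ-map p g xs)) ⟩
  length (filterᵇ p (map g xs))      ≡⟨ ↭-length (filter-↭ (T? ∘ p) g↭) ⟩
  length (filterᵇ p xs)              ∎

-- Insertion sort by a key k, used only to show that a sorting permutation exists.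
insertBy : (ℕ → ℕ) → ℕ → List ℕ → List ℕ
insertBy k x []       = x ∷ []
insertBy k x (y ∷ ys) = if k x ≤ᵇ k y then x ∷ y ∷ ys else y ∷ insertBy k x ys

sortBy : (ℕ → ℕ) → List ℕ → List ℕ
sortBy k []       = []
sortBy k (x ∷ xs) = insertBy k x (sortBy k xs)

insertBy-↭ : ∀ k x ys → insertBy k x ys ↭ x ∷ ys
insertBy-↭ k x []       = refl
insertBy-↭ k x (y ∷ ys) with k x ≤ᵇ k y
... | true  = refl
... | false = trans (prep y (insertBy-↭ k x ys)) (swap y x refl)

sortBy-↭ : ∀ k xs → sortBy k xs ↭ xs
sortBy-↭ k []       = refl
sortBy-↭ k (x ∷ xs) = trans (insertBy-↭ k x (sortBy k xs)) (prep x (sortBy-↭ k xs))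

sorted-∷ : ∀ a b xs → a ≤ b → sortedᵇ (b ∷ xs) ≡ true → sortedᵇ (a ∷ b ∷ xs) ≡ true
sorted-∷ a b xs a≤b sorted with a ≤ᵇ b in e
... | true  = sorted
... | false = ⊥-elim (subst T e (ℕ.≤⇒≤ᵇ a≤b))

sorted-∷⁻ : ∀ a b xs → sortedᵇ (a ∷ b ∷ xs) ≡ true → a ≤ b × sortedᵇ (b ∷ xs) ≡ true
sorted-∷⁻ a b xs sorted with a ≤ᵇ b in e
... | true  = ℕ.≤ᵇ⇒≤ a b (subst T (≡.sym e) _) , sorted

≰ᵇ⇒≥ : ∀ a b → (a ≤ᵇ b) ≡ false → b ≤ a
≰ᵇ⇒≥ a b e = ℕ.≰⇒≥ (λ a≤b → subst T e (ℕ.≤⇒≤ᵇ a≤b))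

insertBy-sorted-above : ∀ k z x ys → z ≤ k x → sortedᵇ (z ∷ map k ys) ≡ true → sortedᵇ (z ∷ map k (insertBy k x ys)) ≡ true
insertBy-sorted-above k z x []       z≤ _      = sorted-∷ z (k x) [] z≤ ≡.refl
insertBy-sorted-above k z x (y ∷ ys) z≤ sorted with z≤y , sorted′ ← sorted-∷⁻ z (k y) (map k ys) sorted
  with k x ≤ᵇ k y in e
... | true  = sorted-∷ z (k x) (k y ∷ map k ys) z≤ (sorted-∷ (k x) (k y) (map k ys) (ℕ.≤ᵇ⇒≤ _ _ (subst T (≡.sym e) _)) sorted′)
... | false = sorted-∷ z (k y) (map k (insertBy k x ys)) z≤y (insertBy-sorted-above k (k y) x ys (≰ᵇ⇒≥ _ _ e) sorted′)

insertBy-sorted : ∀ k x ys → sortedᵇ (map k ys) ≡ true → sortedᵇ (map k (insertBy k x ys)) ≡ true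
insertBy-sorted k x []       _      = ≡.refl
insertBy-sorted k x (y ∷ ys) sorted with k x ≤ᵇ k y in e
... | true  = sorted-∷ (k x) (k y) (map k ys) (ℕ.≤ᵇ⇒≤ _ _ (subst T (≡.sym e) _)) sorted
... | false = insertBy-sorted-above k (k y) x ys (≰ᵇ⇒≥ _ _ e) sorted

sortBy-sorted : ∀ k xs → sortedᵇ (map k (sortBy k xs)) ≡ true
sortBy-sorted k []       = ≡.refl
sortBy-sorted k (x ∷ xs) = insertBy-sorted k x (sortBy k xs) (sortBy-sorted k xs)

sorting-permutation : ∀ n (k : ℕ → ℕ) → Σ[ ν ∈ List ℕ ] (ν ∈ 𝔖 n × sortedᵇ (map k ν) ≡ true)
sorting-permutation n k = sortBy k (upTo n) , ↭⇒∈perms (upTo n) (sortBy-↭ k (upTo n)) , sortBy-sorted k (upTo n)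

table∈𝔖 : ∀ s (σ : Permutation′ s) → table s σ ∈ 𝔖 s
table∈𝔖 s σ = ↭⇒∈perms (upTo s) (unique-↭ (Unique.map⁺ image-injective (Unique.allFin⁺ s)) (Unique.upTo⁺ s) image⊆
  (ℕ.≤-reflexive (≡.trans (List.length-upTo s) (≡.sym (≡.trans (List.length-map image (allFin s)) (List.length-tabulate id))))))
  where
  image : Fin s → ℕ
  image t = toℕ (σ ⟨$⟩ʳ t)
  image-injective : ∀ {x y} → image x ≡ image y → x ≡ y
  image-injective {x} {y} eq = ≡.trans (≡.sym (inverseˡ σ)) (≡.trans (cong (σ ⟨$⟩ˡ_) (Fin.toℕ-injective eq)) (inverseˡ σ))
  image⊆ : map image (allFin s) ⊆ upTo s
  image⊆ y∈ with t , _ , ≡.refl ← ∈-map⁻ image y∈ = ∈-upTo⁺ (Fin.toℕ<n _)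

take-length-++ : {A : Set} (xs ys : List A) → take (length xs) (xs ++ ys) ≡ xs
take-length-++ []       ys = ≡.refl
take-length-++ (x ∷ xs) ys = cong (x ∷_) (take-length-++ xs ys)

-- For a fixed duplicate-free list P of positions below N, the family of
-- sequences π ⊙ P (π ∈ 𝔖_N) is, as a multiset, unchanged by rearranging P: the
-- sum over π of any h (π ⊙ Q) is the same for every rearrangement Q of P.
-- Proof: extend P by its complement R to an arrangement of 0, …, N-1; then
-- π ↦ π ⊙ (Q ++ R) is a right translation of 𝔖_N, and π ⊙ Q is its prefix.
module _ (N : ℕ) (P : List ℕ) (P! : Unique P) (P<N : ∀ {x} → x ∈ P → x < N) where

  private
    complement : List ℕ
    complement = filter (_∉? P) (upTo N)

    P++complement↭ : P ++ complement ↭ upTo N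
    P++complement↭ = ↭-sym (unique-↭ (Unique.upTo⁺ N) P++complement! covers (unique-length P++complement! within))
      where
      P++complement! : Unique (P ++ complement)
      P++complement! = Unique.++⁺ P! (Unique.filter⁺ (_∉? P) (Unique.upTo⁺ N))
                                  (λ (x∈P , x∈c) → proj₂ (∈-filter⁻ (_∉? P) {xs = upTo N} x∈c) x∈P)
      covers : upTo N ⊆ P ++ complement
      covers {x} x∈ with x ∉? P
      ... | yes x∉P = ∈-++⁺ʳ P (∈-filter⁺ (_∉? P) x∈ x∉P)
      ... | no  x∈P = ∈-++⁺ˡ (decidable-stable (_ ∈? P) x∈P)
      within : P ++ complement ⊆ upTo N
      within x∈ with ∈-++⁻ P x∈
      ... | inj₁ x∈P = ∈-upTo⁺ (P<N x∈P)
      ... | inj₂ x∈c = proj₁ (∈-filter⁻ (_∉? P) x∈c)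

    prefix : ∀ (Q π : List ℕ) → take (length Q) (π ⊙ (Q ++ complement)) ≡ π ⊙ Q
    prefix Q π = begin
      take (length Q) (π ⊙ (Q ++ complement))        ≡⟨ cong (take (length Q)) (List.map-++ (nth 0 π) Q complement) ⟩
      take (length Q) (π ⊙ Q ++ π ⊙ complement)      ≡⟨ cong (λ k → take k (π ⊙ Q ++ π ⊙ complement)) (≡.sym (List.length-map (nth 0 π) Q)) ⟩
      take (length (π ⊙ Q)) (π ⊙ Q ++ π ⊙ complement) ≡⟨ take-length-++ (π ⊙ Q) (π ⊙ complement) ⟩
      π ⊙ Q                                          ∎

  ∑-rearranged-positions : (Q : List ℕ) → Q ↭ P → (h : List ℕ → ℚ) →
                           ∑ (𝔖 N) (λ π → h (π ⊙ Q)) ≡ ∑ (𝔖 N) (λ π → h (π ⊙ P))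
  ∑-rearranged-positions Q Q↭P h = begin
    ∑ (𝔖 N) (λ π → h (π ⊙ Q))                  ≡⟨ ∑-cong (𝔖 N) (λ {π} _ → cong h (≡.sym (prefix-of Q (↭-length Q↭P) π))) ⟩
    ∑ (𝔖 N) (λ π → h′ (π ⊙ (Q ++ complement))) ≡⟨ ∑-reindex (_⊙ (Q ++ complement)) (right-translation N (trans (++⁺ʳ complement Q↭P) P++complement↭)) h′ ⟩
    ∑ (𝔖 N) h′                                 ≡⟨ ≡.sym (∑-reindex (_⊙ (P ++ complement)) (right-translation N P++complement↭) h′) ⟩
    ∑ (𝔖 N) (λ π → h′ (π ⊙ (P ++ complement))) ≡⟨ ∑-cong (𝔖 N) (λ {π} _ → cong h (prefix-of P ≡.refl π)) ⟩
    ∑ (𝔖 N) (λ π → h (π ⊙ P))                  ∎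
    where
    h′ : List ℕ → ℚ
    h′ w = h (take (length P) w)
    prefix-of : ∀ R → length R ≡ length P → ∀ π → take (length P) (π ⊙ (R ++ complement)) ≡ π ⊙ R
    prefix-of R len π = subst (λ k → take k (π ⊙ (R ++ complement)) ≡ π ⊙ R) len (prefix R π)

combinations-map : {A B : Set} (f : A → B) (s : ℕ) (xs : List A) → combinations s (map f xs) ≡ map (map f) (combinations s xs)
combinations-map f zero    xs       = ≡.refl
combinations-map f (suc s) []       = ≡.refl
combinations-map f (suc s) (x ∷ xs) = begin
  map (f x ∷_) (combinations s (map f xs)) ++ combinations (suc s) (map f xs)
    ≡⟨ cong₂ (λ l r → map (f x ∷_) l ++ r) (combinations-map f s xs) (combinations-map f (suc s) xs) ⟩
  map (f x ∷_) (map (map f) C) ++ map (map f) C′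
    ≡⟨ cong (_++ map (map f) C′) (≡.trans (≡.sym (List.map-∘ C)) (List.map-∘ C)) ⟩
  map (map f) (map (x ∷_) C) ++ map (map f) C′
    ≡⟨ ≡.sym (List.map-++ (map f) (map (x ∷_) C) C′) ⟩
  map (map f) (map (x ∷_) C ++ C′) ∎
  where
  C  = combinations s xs
  C′ = combinations (suc s) xs

combinations-nonempty : {A : Set} (s : ℕ) (xs : List A) → s ≤ length xs → 1 ≤ length (combinations s xs)
combinations-nonempty zero    xs       _       = s≤s z≤n
combinations-nonempty (suc s) (x ∷ xs) (s≤s s≤n) =
  ℕ.≤-trans (combinations-nonempty s xs s≤n) (subst (length C ≤_) (≡.sym len) (ℕ.m≤m+n (length C) (length C′)))
  where
  C  = combinations s xs
  C′ = combinations (suc s) xs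
  len : length (map (x ∷_) C ++ C′) ≡ length C ℕ.+ length C′
  len = ≡.trans (List.length-++ (map (x ∷_) C)) (cong (ℕ._+ length C′) (List.length-map (x ∷_) C))

combination-properties : {A : Set} (s : ℕ) (xs : List A) {P : List A} → P ∈ combinations s xs →
                         length P ≡ s × P ⊆ xs × (Unique xs → Unique P)
combination-properties zero xs (here ≡.refl) = ≡.refl , (λ ()) , (λ _ → [])
combination-properties (suc s) (x ∷ xs) P∈ with ∈-++⁻ (map (x ∷_) (combinations s xs)) P∈
... | inj₂ P∈′ with len , P⊆ , P! ← combination-properties (suc s) xs P∈′ =
  len , there ∘ P⊆ , λ { (_ ∷ xs!) → P! xs! }
... | inj₁ P∈′ with P′ , P′∈ , ≡.refl ← ∈-map⁻ (x ∷_) P∈′ with len , P⊆ , P! ← combination-properties s xs P′∈ =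
  cong suc len , ⊆-∷ , λ { (x∉xs ∷ xs!) → All.tabulate (λ y∈ → All.lookup x∉xs (P⊆ y∈)) ∷ P! xs! }
  where
  ⊆-∷ : x ∷ P′ ⊆ x ∷ xs
  ⊆-∷ (here eq)  = here eq
  ⊆-∷ (there y∈) = there (P⊆ y∈)

avg-map : {A B : Set} (g : A → B) (xs : List A) (f : B → ℚ) → avg (map g xs) f ≡ avg xs (f ∘ g)
avg-map g xs f = cong₂ _/ℕ_ (∑-map g xs f) (List.length-map g xs)

filterᵇ-cong-∈ : {A : Set} (xs : List A) {p q : A → Bool} → (∀ {x} → x ∈ xs → p x ≡ q x) → filterᵇ p xs ≡ filterᵇ q xs
filterᵇ-cong-∈ []       p≗q = ≡.refl
filterᵇ-cong-∈ (x ∷ xs) {p} {q} p≗q with p x | q x | p≗q (here ≡.refl)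
... | true  | true  | _ = cong (x ∷_) (filterᵇ-cong-∈ xs (p≗q ∘ there))
... | false | false | _ = filterᵇ-cong-∈ xs (p≗q ∘ there)

filterᵇ-nonempty : {A : Set} (p : A → Bool) {xs : List A} {x : A} → x ∈ xs → p x ≡ true → 1 ≤ length (filterᵇ p xs)
filterᵇ-nonempty p x∈ px = ∈-length (∈-filter⁺ (T? ∘ p) x∈ (subst T (≡.sym px) _))

∑-indicator-absent : (xs : List (List ℕ)) (p : List ℕ → Bool) (τ : List ℕ) → All (_≢ τ) xs →
                     ∑ xs (λ σ → if p σ then indicator σ τ else 0ℚ) ≡ 0ℚ
∑-indicator-absent []       p τ []           = ≡.refl
∑-indicator-absent (σ ∷ xs) p τ (σ≢τ ∷ xs≢τ) with p σ | List.≡-dec ℕ._≟_ σ τ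
... | true  | yes σ≡τ = ⊥-elim (σ≢τ σ≡τ)
... | true  | no  _   = ≡.trans (+-identityˡ _) (∑-indicator-absent xs p τ xs≢τ)
... | false | _       = ≡.trans (+-identityˡ _) (∑-indicator-absent xs p τ xs≢τ)

∑-indicator : (xs : List (List ℕ)) (p : List ℕ → Bool) (τ : List ℕ) → Unique xs → τ ∈ xs →
              ∑ xs (λ σ → if p σ then indicator σ τ else 0ℚ) ≡ [ p τ ]
∑-indicator (σ ∷ xs) p τ (σ∉xs ∷ _) (here ≡.refl) with List.≡-dec ℕ._≟_ σ σ | p σ
... | no  σ≢σ | _     = ⊥-elim (σ≢σ ≡.refl)
... | yes _   | true  = ≡.trans (cong (1ℚ +_) (∑-indicator-absent xs p σ (All.map (λ ne → ne ∘ ≡.sym) σ∉xs))) (+-identityʳ 1ℚ)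
... | yes _   | false = ≡.trans (+-identityˡ _) (∑-indicator-absent xs p σ (All.map (λ ne → ne ∘ ≡.sym) σ∉xs))
∑-indicator (σ ∷ xs) p τ (σ∉xs ∷ xs!) (there τ∈) with List.≡-dec ℕ._≟_ σ τ | p σ
... | yes ≡.refl | _     = ⊥-elim (All.lookup σ∉xs τ∈ ≡.refl)
... | no  _      | true  = ≡.trans (+-identityˡ _) (∑-indicator xs p τ xs! τ∈)
... | no  _      | false = ≡.trans (+-identityˡ _) (∑-indicator xs p τ xs! τ∈)

module Uniformity (hL hR : List ℕ) (s : ℕ) {τ₀ : List ℕ} (τ₀∈𝔖 : τ₀ ∈ 𝔖 s) where

  hr : ℕ → ℕ
  hr = nth 0 hR

  rightSorts : List ℕ → List ℕ → Bool
  rightSorts v ν = sortedᵇ (map hr (v ⊙ ν))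

  #rightSorts : List ℕ → ℕ
  #rightSorts v = length (filterᵇ (rightSorts v) (𝔖 s))

  -- Probability that the identity is drawn uniformly among the orderings that
  -- sort the right half-edges v.
  weight : List ℕ → ℚ
  weight v = [ sortedᵇ (map hr v) ] /ℕ #rightSorts v

  #rightSorts-⊙ : ∀ v {μ} → μ ∈ 𝔖 s → #rightSorts (v ⊙ μ) ≡ #rightSorts v
  #rightSorts-⊙ v {μ} μ∈ = ≡.trans
    (cong length (filterᵇ-cong-∈ (𝔖 s) (λ {ν} ν∈ → cong (sortedᵇ ∘ map hr) (⊙-assoc v μ ν (𝔖-position s ν∈ μ (𝔖-length s μ∈))))))
    (count-reindex (μ ⊙_) (left-translation s μ∈) (rightSorts v))

  #rightSorts-pos : ∀ v → 1 ≤ #rightSorts v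
  #rightSorts-pos v with ν , ν∈ , sorted ← sorting-permutation s (hr ∘ nth 0 v) =
    filterᵇ-nonempty (rightSorts v) ν∈ (≡.trans (cong sortedᵇ (≡.sym (List.map-∘ ν))) sorted)

  compatible-average : ∀ v (ℓ : List Edge) → (∀ t → t < s → proj₂ (nth (0 , 0) ℓ t) ≡ hr (nth 0 v t)) →
                       avg (compatible s ℓ) (λ σ → indicator σ τ₀) ≡ weight (v ⊙ τ₀)
  compatible-average v ℓ labels = begin
    avg (compatible s ℓ) (λ σ → indicator σ τ₀)                                  ≡⟨ cong (λ xs → avg xs (λ σ → indicator σ τ₀)) compatible≡ ⟩
    ∑ (filterᵇ (rightSorts v) (𝔖 s)) (λ σ → indicator σ τ₀) /ℕ #rightSorts v    ≡⟨ cong (_/ℕ #rightSorts v) (∑-filter (rightSorts v) (𝔖 s) _) ⟩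
    ∑ (𝔖 s) (λ σ → if rightSorts v σ then indicator σ τ₀ else 0ℚ) /ℕ #rightSorts v ≡⟨ cong (_/ℕ #rightSorts v) (∑-indicator (𝔖 s) (rightSorts v) τ₀ (𝔖-unique s) τ₀∈𝔖) ⟩
    [ rightSorts v τ₀ ] /ℕ #rightSorts v                                           ≡⟨ cong ([ rightSorts v τ₀ ] /ℕ_) (≡.sym (#rightSorts-⊙ v τ₀∈𝔖)) ⟩
    weight (v ⊙ τ₀)                                                                ∎
    where
    compatible≡ : compatible s ℓ ≡ filterᵇ (rightSorts v) (𝔖 s)
    compatible≡ = filterᵇ-cong-∈ (𝔖 s) (λ {σ} σ∈ → cong sortedᵇ
      (≡.trans (map-cong-∈ σ (λ {t} t∈ → labels t (𝔖-bounded s σ∈ t∈))) (List.map-∘ σ)))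

  weight-total : ∀ v → ∑ (𝔖 s) (λ μ → weight (v ⊙ μ)) ≡ 1ℚ
  weight-total v = begin
    ∑ (𝔖 s) (λ μ → weight (v ⊙ μ))                     ≡⟨ ∑-cong (𝔖 s) (λ {μ} μ∈ → cong ([ rightSorts v μ ] /ℕ_) (#rightSorts-⊙ v μ∈)) ⟩
    ∑ (𝔖 s) (λ μ → [ rightSorts v μ ] /ℕ #rightSorts v) ≡⟨ ∑-/ℕ (𝔖 s) (#rightSorts v) (λ μ → [ rightSorts v μ ]) ⟩
    ∑ (𝔖 s) (λ μ → [ rightSorts v μ ]) /ℕ #rightSorts v ≡⟨ cong (_/ℕ #rightSorts v) (≡.sym (count≡∑ (rightSorts v) (𝔖 s))) ⟩
    fromℕ (#rightSorts v) /ℕ #rightSorts v              ≡⟨ /ℕ-unique (#rightSorts v) _ 1ℚ (#rightSorts-pos v) (*-identityʳ _) ⟩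
    1ℚ                                                   ∎

  edge : List ℕ → ℕ → Edge
  edge π p = nth 0 hL p , hr (nth 0 π p)

  leftSorts : List ℕ → List ℕ → Bool
  leftSorts P α = sortedᵇ (map (nth 0 hL) (P ⊙ α))

  leftSortings : List ℕ → List (List ℕ)
  leftSortings P = filterᵇ (leftSorts P) (𝔖 s)

  leftSortings-nonempty : ∀ P → 1 ≤ length (leftSortings P)
  leftSortings-nonempty P with α , α∈ , sorted ← sorting-permutation s (nth 0 hL ∘ nth 0 P) =
    filterᵇ-nonempty (leftSorts P) α∈ (≡.trans (cong sortedᵇ (≡.sym (List.map-∘ α))) sorted)

  module _ (π P : List ℕ) (P-length : length P ≡ s) where

    read-edges : ∀ {α} → α ∈ 𝔖 s → map (nth (0 , 0) (map (edge π) P)) α ≡ map (edge π) (P ⊙ α)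
    read-edges {α} α∈ = ≡.trans (map-cong-∈ α (λ {t} t∈ → nth-map (edge π) 0 (0 , 0) P t (𝔖-position s α∈ P P-length t∈)))
                                (List.map-∘ α)

    listings-by-positions : listings (map (edge π) P) ≡ map (map (nth (0 , 0) (map (edge π) P))) (leftSortings P)
    listings-by-positions = begin
      filterᵇ leftSorted (perms S)                                  ≡⟨ cong (filterᵇ leftSorted) (perms-positions (0 , 0) S) ⟩
      filterᵇ leftSorted (map read (perms (upTo (length S))))       ≡⟨ cong (λ k → filterᵇ leftSorted (map read (perms (upTo k)))) S-length ⟩
      filterᵇ leftSorted (map read (𝔖 s))                           ≡⟨ filterᵇ-map leftSorted read (𝔖 s) ⟩
      map read (filterᵇ (leftSorted ∘ read) (𝔖 s))                  ≡⟨ cong (map read) (filterᵇ-cong-∈ (𝔖 s) same-test) ⟩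
      map read (leftSortings P)                                     ∎
      where
      S = map (edge π) P
      read : List ℕ → List Edge
      read = map (nth (0 , 0) S)
      leftSorted : List Edge → Bool
      leftSorted ℓ = sortedᵇ (map proj₁ ℓ)
      S-length : length S ≡ s
      S-length = ≡.trans (List.length-map (edge π) P) P-length
      same-test : ∀ {α} → α ∈ 𝔖 s → leftSorted (read α) ≡ leftSorts P α
      same-test {α} α∈ = ≡.trans (cong (sortedᵇ ∘ map proj₁) (read-edges α∈)) (cong sortedᵇ (≡.sym (List.map-∘ (P ⊙ α))))

    listing-average : avg (listings (map (edge π) P)) (λ ℓ → avg (compatible s ℓ) (λ σ → indicator σ τ₀))
                      ≡ ∑ (leftSortings P) (λ α → weight (π ⊙ (P ⊙ (α ⊙ τ₀)))) /ℕ length (leftSortings P)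
    listing-average = begin
      avg (listings S) I                                   ≡⟨ cong (λ xs → avg xs I) listings-by-positions ⟩
      avg (map (map (nth (0 , 0) S)) (leftSortings P)) I    ≡⟨ avg-map _ (leftSortings P) I ⟩
      avg (leftSortings P) (I ∘ map (nth (0 , 0) S))        ≡⟨ cong (_/ℕ length (leftSortings P)) (∑-cong (leftSortings P) (λ α∈ → reading (proj₁ (∈-filter⁻ (T? ∘ leftSorts P) {xs = 𝔖 s} α∈)))) ⟩
      ∑ (leftSortings P) (λ α → weight (π ⊙ (P ⊙ (α ⊙ τ₀)))) /ℕ length (leftSortings P) ∎
      where
      S = map (edge π) P
      I : List Edge → ℚ
      I ℓ = avg (compatible s ℓ) (λ σ → indicator σ τ₀)
      reading : ∀ {α} → α ∈ 𝔖 s → I (map (nth (0 , 0) S) α) ≡ weight (π ⊙ (P ⊙ (α ⊙ τ₀)))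
      reading {α} α∈ = begin
        I (map (nth (0 , 0) S) α)         ≡⟨ cong I (read-edges α∈) ⟩
        I (map (edge π) (P ⊙ α))          ≡⟨ compatible-average (π ⊙ (P ⊙ α)) (map (edge π) (P ⊙ α)) right-labels ⟩
        weight ((π ⊙ (P ⊙ α)) ⊙ τ₀)       ≡⟨ cong weight (⊙-assoc π (P ⊙ α) τ₀ (𝔖-position s τ₀∈𝔖 (P ⊙ α) Pα-length)) ⟩
        weight (π ⊙ ((P ⊙ α) ⊙ τ₀))       ≡⟨ cong (λ w → weight (π ⊙ w)) (⊙-assoc P α τ₀ (𝔖-position s τ₀∈𝔖 α (𝔖-length s α∈))) ⟩
        weight (π ⊙ (P ⊙ (α ⊙ τ₀)))       ∎
        where
        Pα-length : length (P ⊙ α) ≡ s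
        Pα-length = ≡.trans (List.length-map (nth 0 P) α) (𝔖-length s α∈)
        right-labels : ∀ t → t < s → proj₂ (nth (0 , 0) (map (edge π) (P ⊙ α)) t) ≡ hr (nth 0 (π ⊙ (P ⊙ α)) t)
        right-labels t t<s = begin
          proj₂ (nth (0 , 0) (map (edge π) (P ⊙ α)) t) ≡⟨ cong proj₂ (nth-map (edge π) 0 (0 , 0) (P ⊙ α) t t<len) ⟩
          hr (nth 0 π (nth 0 (P ⊙ α) t))               ≡⟨ cong hr (≡.sym (nth-map (nth 0 π) 0 0 (P ⊙ α) t t<len)) ⟩
          hr (nth 0 (π ⊙ (P ⊙ α)) t)                   ∎
          where
          t<len : t < length (P ⊙ α)
          t<len = subst (t <_) (≡.sym Pα-length) t<s

  sampleProb : List Edge → ℚ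
  sampleProb S = avg (listings S) (λ ℓ → avg (compatible s ℓ) (λ σ → indicator σ τ₀))

  module _ (N : ℕ) (P : List ℕ) (P-length : length P ≡ s) (P! : Unique P) (P<N : ∀ {x} → x ∈ P → x < N) where

    totalWeight : ℚ
    totalWeight = ∑ (𝔖 N) (λ π → weight (π ⊙ P))

    totalWeight-reordered : ∀ {μ} → μ ∈ 𝔖 s → ∑ (𝔖 N) (λ π → weight (π ⊙ (P ⊙ μ))) ≡ totalWeight
    totalWeight-reordered {μ} μ∈ = ∑-rearranged-positions N P P! P<N (P ⊙ μ) (⊙-↭ s P μ P-length (𝔖-↭ s μ∈)) weight

    -- Summing the previous identity over μ and using weight-total: s! · total = N!.
    totalWeight-value : fromℕ (s !) * totalWeight ≡ fromℕ (N !)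
    totalWeight-value = begin
      fromℕ (s !) * totalWeight                                  ≡⟨ cong (λ k → fromℕ k * totalWeight) (≡.sym (length-𝔖 s)) ⟩
      fromℕ (length (𝔖 s)) * totalWeight                         ≡⟨ ≡.sym (∑-const (𝔖 s) totalWeight) ⟩
      ∑ (𝔖 s) (λ _ → totalWeight)                                ≡⟨ ∑-cong (𝔖 s) (λ μ∈ → ≡.sym (totalWeight-reordered μ∈)) ⟩
      ∑ (𝔖 s) (λ μ → ∑ (𝔖 N) (λ π → weight (π ⊙ (P ⊙ μ))))      ≡⟨ ∑-swap (𝔖 s) (𝔖 N) _ ⟩
      ∑ (𝔖 N) (λ π → ∑ (𝔖 s) (λ μ → weight (π ⊙ (P ⊙ μ))))      ≡⟨ ∑-cong (𝔖 N) (λ {π} _ → ∑-cong (𝔖 s) (λ {μ} μ∈ → cong weight (≡.sym (⊙-assoc π P μ (𝔖-position s μ∈ P P-length))))) ⟩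
      ∑ (𝔖 N) (λ π → ∑ (𝔖 s) (λ μ → weight ((π ⊙ P) ⊙ μ)))      ≡⟨ ∑-cong (𝔖 N) (λ {π} _ → weight-total (π ⊙ P)) ⟩
      ∑ (𝔖 N) (λ _ → 1ℚ)                                         ≡⟨ ∑-const (𝔖 N) 1ℚ ⟩
      fromℕ (length (𝔖 N)) * 1ℚ                                  ≡⟨ *-identityʳ _ ⟩
      fromℕ (length (𝔖 N))                                       ≡⟨ cong fromℕ (length-𝔖 N) ⟩
      fromℕ (N !)                                                ∎

    -- Averaging over the left-sorted listings only averages copies of the total weight.
    ∑-sampleProb : ∑ (𝔖 N) (λ π → sampleProb (map (edge π) P)) ≡ fromℕ (N !) /ℕ (s !)
    ∑-sampleProb = begin
      ∑ (𝔖 N) (λ π → sampleProb (map (edge π) P))                         ≡⟨ ∑-cong (𝔖 N) (λ {π} _ → listing-average π P P-length) ⟩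
      ∑ (𝔖 N) (λ π → X π /ℕ length LS)                                     ≡⟨ ∑-/ℕ (𝔖 N) (length LS) X ⟩
      ∑ (𝔖 N) X /ℕ length LS                                               ≡⟨ cong (_/ℕ length LS) (∑-swap (𝔖 N) LS _) ⟩
      ∑ LS (λ α → ∑ (𝔖 N) (λ π → weight (π ⊙ (P ⊙ (α ⊙ τ₀))))) /ℕ length LS ≡⟨ cong (_/ℕ length LS) (∑-cong LS (λ α∈ → totalWeight-reordered (⊙-closed s (proj₁ (∈-filter⁻ (T? ∘ leftSorts P) {xs = 𝔖 s} α∈)) τ₀∈𝔖))) ⟩
      ∑ LS (λ _ → totalWeight) /ℕ length LS                                ≡⟨ /ℕ-unique (length LS) _ totalWeight (leftSortings-nonempty P) (≡.sym (∑-const LS totalWeight)) ⟩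
      totalWeight                                                          ≡⟨ ≡.sym (/ℕ-unique (s !) _ totalWeight (ℕ.1≤n! s) totalWeight-value) ⟩
      fromℕ (N !) /ℕ (s !)                                                 ∎
      where
      LS = leftSortings P
      X : List ℕ → ℚ
      X π = ∑ LS (λ α → weight (π ⊙ (P ⊙ (α ⊙ τ₀))))

  induced-uniform : s ≤ length hL →
    avg (𝔖 (length hL)) (λ π → avg (combinations s (edgesOf hL hR π)) sampleProb) ≡ 1ℚ /ℕ (s !)
  induced-uniform s≤N = begin
    ∑ (𝔖 N) (λ π → avg (combinations s (edgesOf hL hR π)) sampleProb) /ℕ length (𝔖 N)       ≡⟨ cong (_/ℕ length (𝔖 N)) (∑-cong (𝔖 N) (λ {π} _ → samples-by-positions π)) ⟩
    ∑ (𝔖 N) (λ π → ∑ Cs (λ P → sampleProb (map (edge π) P)) /ℕ length Cs) /ℕ length (𝔖 N)  ≡⟨ cong (_/ℕ length (𝔖 N)) (∑-/ℕ (𝔖 N) (length Cs) _) ⟩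
    (∑ (𝔖 N) (λ π → ∑ Cs (λ P → sampleProb (map (edge π) P))) /ℕ length Cs) /ℕ length (𝔖 N) ≡⟨ cong (λ t → (t /ℕ length Cs) /ℕ length (𝔖 N)) (∑-swap (𝔖 N) Cs _) ⟩
    (∑ Cs (λ P → ∑ (𝔖 N) (λ π → sampleProb (map (edge π) P))) /ℕ length Cs) /ℕ length (𝔖 N) ≡⟨ cong (λ t → (t /ℕ length Cs) /ℕ length (𝔖 N)) (∑-cong Cs per-sample) ⟩
    (∑ Cs (λ _ → K) /ℕ length Cs) /ℕ length (𝔖 N)                                          ≡⟨ cong (_/ℕ length (𝔖 N)) (/ℕ-unique (length Cs) _ K Cs-nonempty (≡.sym (∑-const Cs K))) ⟩
    K /ℕ length (𝔖 N)                                                                       ≡⟨ /ℕ-unique (length (𝔖 N)) K (1ℚ /ℕ (s !)) 𝔖-nonempty N!*1/s! ⟩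
    1ℚ /ℕ (s !)                                                                      ∎
    where
    N  = length hL
    Cs = combinations s (upTo N)
    K  = fromℕ (N !) /ℕ (s !)
    samples-by-positions : ∀ π → avg (combinations s (edgesOf hL hR π)) sampleProb ≡ ∑ Cs (λ P → sampleProb (map (edge π) P)) /ℕ length Cs
    samples-by-positions π = ≡.trans (cong (λ xs → avg xs sampleProb) (combinations-map (edge π) s (upTo N)))
                                     (avg-map (map (edge π)) Cs sampleProb)
    per-sample : ∀ {P} → P ∈ Cs → ∑ (𝔖 N) (λ π → sampleProb (map (edge π) P)) ≡ K
    per-sample P∈ with P-length , P⊆ , P! ← combination-properties s (upTo N) P∈ =
      ∑-sampleProb N _ P-length (P! (Unique.upTo⁺ N)) (∈-upTo⁻ ∘ P⊆)
    Cs-nonempty : 1 ≤ length Cs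
    Cs-nonempty = combinations-nonempty s (upTo N) (subst (s ≤_) (≡.sym (List.length-upTo N)) s≤N)
    𝔖-nonempty : 1 ≤ length (𝔖 N)
    𝔖-nonempty = subst (1 ≤_) (≡.sym (length-𝔖 N)) (ℕ.1≤n! N)
    N!*1/s! : fromℕ (length (𝔖 N)) * (1ℚ /ℕ (s !)) ≡ K
    N!*1/s! = ≡.trans (cong (λ n → fromℕ n * (1ℚ /ℕ (s !))) (length-𝔖 N)) (*-1/ℕ (fromℕ (N !)) (s !))

length-halfEdgesFrom : ∀ i ws → length (halfEdgesFrom i ws) ≡ sumℕ ws
length-halfEdgesFrom i []       = ≡.refl
length-halfEdgesFrom i (w ∷ ws) =
  ≡.trans (List.length-++ (replicate w i)) (cong₂ ℕ._+_ (List.length-replicate w) (length-halfEdgesFrom (suc i) ws))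

inducedProb-uniform : (w d : List ℕ) (s : ℕ) (σ₀ : Permutation′ s) → s ≤ sumℕ w →
                      inducedProb w d s (table s σ₀) ≡ 1ℚ /ℕ (s !)
inducedProb-uniform w d s σ₀ s≤N =
  Uniformity.induced-uniform (halfEdges w) (halfEdges d) s (table∈𝔖 s σ₀)
    (subst (s ≤_) (≡.sym (length-halfEdgesFrom 0 w)) s≤N)

lemma5 : (w d : ℕ → List ℕ)
    → (∀ k → All (1 ≤_) (w k))
    → (∀ k → All (1 ≤_) (d k))
    → (∀ k → sumℕ (w k) ≡ sumℕ (d k))
    → TendsToInfinity (λ k → length (w k))
    → TendsToInfinity (λ k → length (d k))
    → TendsToInfinity (λ k → sumℕ (w k))
    → ∀ s → 2 ≤ s → BlockFreeOfOrder w d s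
lemma5 w d _ _ _ _ _ N→∞ s _ σ₀ ε ε>0 with K , s≤N ← N→∞ s = K , close
  where
  -- From index K on there are at least s edges, so the error is exactly 0.
  close : ∀ k → K ≤ k → ∣ inducedProb (w k) (d k) s (table s σ₀) - 1ℚ /ℕ (s !) ∣ ℚ.≤ ε
  close k K≤k = subst (ℚ._≤ ε) (≡.sym (begin
    ∣ inducedProb (w k) (d k) s (table s σ₀) - 1ℚ /ℕ (s !) ∣ ≡⟨ cong (λ p → ∣ p - 1ℚ /ℕ (s !) ∣) (inducedProb-uniform (w k) (d k) s σ₀ (s≤N k K≤k)) ⟩
    ∣ 1ℚ /ℕ (s !) - 1ℚ /ℕ (s !) ∣                          ≡⟨ cong ∣_∣ (+-inverseʳ (1ℚ /ℕ (s !))) ⟩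
    0ℚ                                                     ∎)) (<⇒≤ ε>0)
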